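{- Let $X$ be a finite nonempty set and let $Q$ be a quintet system in $X$ which is thin, transitive and saturated. Then there do not exist $a,b,c,d,x,y\in X$ such that $(a,c\,|\,b,d,y)\in Q$ and at least one of $(b,x\,|\,a,c,d)$, $(a,b\,|\,c,d\,|\,x)$ belongs to $Q$.
   Context: A quintet in $X$ is a partition of a $5$-element subset of $X$ whose block sizes are $(2,2,1)$, $(3,2)$ or $(5)$. For pairwise distinct $a,b,c,d,e\in X$ write $(a,b\,|\,c,d\,|\,e)$ for $\{\{a,b\},\{c,d\},\{e\}\}$, $(a,b\,|\,c,d,e)$ for $\{\{a,b\},\{c,d,e\}\}$, and $(a,b,c,d,e)$ for $\{\{a,b,c,d,e\}\}$ (order inside blocks and order of blocks of equal size are irrelevant). A quintet system in $X$ is a set $Q$ of quintets in $X$. Write $(a_1,a_2\,|\,\overline{b_1,b_2,b_3})$ for the statement that at least one of $(a_1,a_2|b_1,b_2,b_3)$, $(a_1,a_2|b_1,b_2|b_3)$, $(a_1,a_2|b_1,b_3|b_2)$, $(a_1,a_2|b_2,b_3|b_1)$ belongs to $Q$. In each condition below, "$P$" means $P\in Q$, and the condition is required for every choice of letters in $X$ such that all letters occurring in that condition are pairwise distinct. $Q$ is saturated if: (i) $(a_1,a_2|b_1,b_2|c)\Rightarrow (a_1,a_2|b_1,b_2|x)\vee(a_1,x|b_1,b_2|c)\vee(a_1,a_2|b_1,x|c)$; (ii) $(a_1,a_2|b_1,b_2,b_3)\Rightarrow (a_1,x|b_1,b_2,b_3)\vee(a_1,a_2|\overline{b_1,b_2,x})$;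 (iii) $(a_1,a_2,a_3,a_4,a_5)\Rightarrow (a_1,a_2,a_3,a_4,x)\vee(a_1,x|a_2,a_3,a_4)\vee(a_2,x|a_1,a_3,a_4)\vee(a_3,x|a_1,a_2,a_4)\vee(a_4,x|a_1,a_2,a_3)$. $Q$ is transitive if: (i) $(a_1,a_2|b_1,x|c_1)\wedge(a_1,a_2|b_1,x|c_2)\Rightarrow(a_1,a_2|\overline{c_1,c_2,b_1})$; (ii) $(a_1,a_2|b_1,x|c_1)\wedge(a_1,a_2|b_2,x|c_1)\Rightarrow(a_1,a_2|b_1,b_2|c_1)$; (iii) $(a_1,x|b_1,b_2,b_3)\wedge(a_2,x|b_1,b_2,b_3)\Rightarrow(a_1,a_2|b_1,b_2,b_3)$; (iv) $(a_1,a_2|b_1,b_3,x)\wedge(a_1,a_2|b_2,b_3,x)\Rightarrow(a_1,a_2|b_1,b_2,b_3)\vee(a_1,a_2|b_1,b_2|b_3)$; (v) $(a_1,a_2|b_1,x,b_2)\wedge(a_1,a_2|b_1,x|b_3)\Rightarrow(a_1,a_2|b_1,b_2|b_3)$; (vi) $(a_1,a_2|b_1,b_2|x)\wedge(a_1,a_2|b_1,b_3,x)\Rightarrow(a_1,a_2|b_1,b_2|b_3)$. $Q$ is thin if for every $5$-subset $Y$ of $X$ exactly one quintet on $Y$ belongs to $Q$, and none of the following occurs: (i) $(a,b|c,x|d)\wedge(a,c|b,y|d)$; (ii) $(a,b|c,d,x)\wedge(a,y|b,c,d)$; (iii) $(a,b|c,x|d)\wedge(a,c,d|b,y)$; (iv)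 $(a,x|b,c,d)\wedge(a,d|b,c|y)$. -}

module Defs where

open import Data.List using (List; []; _∷_)
open import Data.List.Relation.Unary.Any using (Any)
open import Data.List.Membership.Propositional using (_∈_)
open import Data.List.Relation.Unary.Unique.Propositional using (Unique)
open import Data.Product using (_×_; ∃-syntax)
open import Data.Sum using (_⊎_)
open import Relation.Nullary using (¬_)
open import Function.Bundles using (_⇔_)

-- Raw notations for quintets:
--   q221 a b c d e  stands for (a,b | c,d | e)
--   q32  a b c d e  stands for (a,b | c,d,e)
--   q5   a b c d e  stands for (a,b,c,d,e)
-- A raw notation denotes a quintet only when its five letters are pairwise
-- distinct (Valid).  Two raw notations denote the same quintet iff they
-- induce the same "same block" relation (this determines both the
-- underlying 5-set and the partition of it).
data Quintet (X : Set) : Set where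
  q221 q32 q5 : X → X → X → X → X → Quintet X

module _ {X : Set} where

  letters : Quintet X → List X
  letters (q221 a b c d e) = a ∷ b ∷ c ∷ d ∷ e ∷ []
  letters (q32 a b c d e) = a ∷ b ∷ c ∷ d ∷ e ∷ []
  letters (q5 a b c d e) = a ∷ b ∷ c ∷ d ∷ e ∷ []

  blocks : Quintet X → List (List X)
  blocks (q221 a b c d e) = (a ∷ b ∷ []) ∷ (c ∷ d ∷ []) ∷ (e ∷ []) ∷ []
  blocks (q32 a b c d e) = (a ∷ b ∷ []) ∷ (c ∷ d ∷ e ∷ []) ∷ []
  blocks (q5 a b c d e) = (a ∷ b ∷ c ∷ d ∷ e ∷ []) ∷ []

  Valid : Quintet X → Set
  Valid P = Unique (letters P)

  SameBlock : Quintet X → X → X → Set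
  SameBlock P x y = Any (λ B → (x ∈ B) × (y ∈ B)) (blocks P)

  _≈Q_ : Quintet X → Quintet X → Set
  P ≈Q P' = ∀ x y → SameBlock P x y ⇔ SameBlock P' x y

  -- the quintet P is a partition of the set (of elements of) Y
  On : Quintet X → List X → Set
  On P Y = ∀ x → SameBlock P x x ⇔ (x ∈ Y)

-- A quintet system: a set of quintets, given as a predicate on raw
-- notations; membership is taken up to equality of quintets.
QuintetSystem : Set → Set₁
QuintetSystem X = Quintet X → Set

module _ {X : Set} where

  infix 4 _∋_
  _∋_ : QuintetSystem X → Quintet X → Set
  Q ∋ P = ∃[ P' ] (Valid P' × Q P' × (P' ≈Q P))

  Bar : QuintetSystem X → X → X → X → X → X → Set
  Bar Q a1 a2 b1 b2 b3 =
    (Q ∋ q32 a1 a2 b1 b2 b3) ⊎ (Q ∋ q221 a1 a2 b1 b2 b3)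
    ⊎ (Q ∋ q221 a1 a2 b1 b3 b2) ⊎ (Q ∋ q221 a1 a2 b2 b3 b1)

  Distinct : List X → Set
  Distinct = Unique

  record Saturated (Q : QuintetSystem X) : Set where
    field
      sat1 : ∀ a1 a2 b1 b2 c x → Distinct (a1 ∷ a2 ∷ b1 ∷ b2 ∷ c ∷ x ∷ []) →
        Q ∋ q221 a1 a2 b1 b2 c →
        (Q ∋ q221 a1 a2 b1 b2 x) ⊎ (Q ∋ q221 a1 x b1 b2 c) ⊎ (Q ∋ q221 a1 a2 b1 x c)
      sat2 : ∀ a1 a2 b1 b2 b3 x → Distinct (a1 ∷ a2 ∷ b1 ∷ b2 ∷ b3 ∷ x ∷ []) →
        Q ∋ q32 a1 a2 b1 b2 b3 →
        (Q ∋ q32 a1 x b1 b2 b3) ⊎ Bar Q a1 a2 b1 b2 x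
      sat3 : ∀ a1 a2 a3 a4 a5 x → Distinct (a1 ∷ a2 ∷ a3 ∷ a4 ∷ a5 ∷ x ∷ []) →
        Q ∋ q5 a1 a2 a3 a4 a5 →
        (Q ∋ q5 a1 a2 a3 a4 x) ⊎ (Q ∋ q32 a1 x a2 a3 a4) ⊎ (Q ∋ q32 a2 x a1 a3 a4)
        ⊎ (Q ∋ q32 a3 x a1 a2 a4) ⊎ (Q ∋ q32 a4 x a1 a2 a3)

  record Transitive (Q : QuintetSystem X) : Set where
    field
      tr1 : ∀ a1 a2 b1 x c1 c2 → Distinct (a1 ∷ a2 ∷ b1 ∷ x ∷ c1 ∷ c2 ∷ []) →
        Q ∋ q221 a1 a2 b1 x c1 → Q ∋ q221 a1 a2 b1 x c2 → Bar Q a1 a2 c1 c2 b1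
      tr2 : ∀ a1 a2 b1 b2 x c1 → Distinct (a1 ∷ a2 ∷ b1 ∷ b2 ∷ x ∷ c1 ∷ []) →
        Q ∋ q221 a1 a2 b1 x c1 → Q ∋ q221 a1 a2 b2 x c1 → Q ∋ q221 a1 a2 b1 b2 c1
      tr3 : ∀ a1 a2 b1 b2 b3 x → Distinct (a1 ∷ a2 ∷ b1 ∷ b2 ∷ b3 ∷ x ∷ []) →
        Q ∋ q32 a1 x b1 b2 b3 → Q ∋ q32 a2 x b1 b2 b3 → Q ∋ q32 a1 a2 b1 b2 b3
      tr4 : ∀ a1 a2 b1 b2 b3 x → Distinct (a1 ∷ a2 ∷ b1 ∷ b2 ∷ b3 ∷ x ∷ []) →
        Q ∋ q32 a1 a2 b1 b3 x → Q ∋ q32 a1 a2 b2 b3 x →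
        (Q ∋ q32 a1 a2 b1 b2 b3) ⊎ (Q ∋ q221 a1 a2 b1 b2 b3)
      tr5 : ∀ a1 a2 b1 b2 b3 x → Distinct (a1 ∷ a2 ∷ b1 ∷ b2 ∷ b3 ∷ x ∷ []) →
        Q ∋ q32 a1 a2 b1 x b2 → Q ∋ q221 a1 a2 b1 x b3 → Q ∋ q221 a1 a2 b1 b2 b3
      tr6 : ∀ a1 a2 b1 b2 b3 x → Distinct (a1 ∷ a2 ∷ b1 ∷ b2 ∷ b3 ∷ x ∷ []) →
        Q ∋ q221 a1 a2 b1 b2 x → Q ∋ q32 a1 a2 b1 b3 x → Q ∋ q221 a1 a2 b1 b2 b3

  record Thin (Q : QuintetSystem X) : Set where
    field
      exists-on : ∀ y1 y2 y3 y4 y5 → Distinct (y1 ∷ y2 ∷ y3 ∷ y4 ∷ y5 ∷ []) →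
        ∃[ P ] (Valid P × On P (y1 ∷ y2 ∷ y3 ∷ y4 ∷ y5 ∷ []) × (Q ∋ P))
      unique-on : ∀ y1 y2 y3 y4 y5 → Distinct (y1 ∷ y2 ∷ y3 ∷ y4 ∷ y5 ∷ []) →
        ∀ P P' → On P (y1 ∷ y2 ∷ y3 ∷ y4 ∷ y5 ∷ []) → On P' (y1 ∷ y2 ∷ y3 ∷ y4 ∷ y5 ∷ []) →
        Q ∋ P → Q ∋ P' → P ≈Q P'
      no1 : ∀ a b c d x y → Distinct (a ∷ b ∷ c ∷ d ∷ x ∷ y ∷ []) →
        ¬ ((Q ∋ q221 a b c x d) × (Q ∋ q221 a c b y d))
      no2 : ∀ a b c d x y → Distinct (a ∷ b ∷ c ∷ d ∷ x ∷ y ∷ []) →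
        ¬ ((Q ∋ q32 a b c d x) × (Q ∋ q32 a y b c d))
      no3 : ∀ a b c d x y → Distinct (a ∷ b ∷ c ∷ d ∷ x ∷ y ∷ []) →
        ¬ ((Q ∋ q221 a b c x d) × (Q ∋ q32 b y a c d))
      no4 : ∀ a b c d x y → Distinct (a ∷ b ∷ c ∷ d ∷ x ∷ y ∷ []) →
        ¬ ((Q ∋ q32 a x b c d) × (Q ∋ q221 a d b c y))

module Submission where

-- Members of Q are valid, so the letters of each of the
-- two quintets are pairwise distinct.  If x = y both quintets live on the
-- same 5-set {a,b,c,d,x} and are different, contradicting thinness.
-- Otherwise the six letters are distinct, and a few applications of the
-- saturation axioms (i), (ii) produce quintets each of which is refuted by
-- thinness: it lives on the same 5-set as another member of Q but differs
-- from it.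
--
-- To compare
-- concrete quintets whose letters are variables, quintets are written over
-- a template alphabet Fin k and renamed along an injective map into X;
-- over Fin k equality of quintets and of their supports is decidable, so
-- the many "these two quintets differ" side conditions are discharged by
-- computation.

open import Defs
open import Data.Nat using (ℕ; suc; _≤_; _<_; s≤s; z≤n)
open import Data.Nat.Properties using (≤-refl; ≤-reflexive; ≤-trans; <-irrefl; module ≤-Reasoning)
open import Data.Fin using (Fin; zero; suc; #_)
import Data.Fin.Properties as Fin
open import Data.List using (List; []; _∷_; map; concat; length; lookup)
open import Data.List.Properties using (length-removeAt′)
open import Data.List.Relation.Unary.Any as Any using (Any; here; there; _─_)
import Data.List.Relation.Unary.Any.Properties as Any
open import Data.List.Relation.Unary.All as All using (All; []; _∷_)
open import Data.List.Relation.Unary.All.Properties using (¬Any⇒All¬)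
open import Data.List.Relation.Unary.AllPairs using ([]; _∷_)
open import Data.List.Membership.Propositional using (_∈_)
open import Data.List.Membership.Propositional.Properties using (∈-map⁺; ∈-map⁻; ∈-lookup)
open import Data.List.Relation.Binary.Subset.Propositional using (_⊆_)
import Data.List.Relation.Binary.Subset.Propositional.Properties as Subset
open import Data.List.Relation.Unary.Unique.Propositional using (Unique)
import Data.List.Relation.Unary.Unique.Propositional.Properties as Unique
open import Data.Product using (_×_; _,_; ∃-syntax; proj₁; proj₂)
open import Data.Sum using (_⊎_; inj₁; inj₂; [_,_])
open import Data.Empty using (⊥; ⊥-elim)
open import Function using (_∘_; case_of_)
open import Function.Bundles using (_⇔_; mk⇔; Equivalence)
import Function.Properties.Equivalence as ⇔
open import Relation.Nullary using (¬_; Dec; yes; no)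
open import Relation.Nullary.Decidable using (True; toWitness; _×-dec_; _→-dec_; ¬?; map′)
open import Relation.Binary.Definitions using (DecidableEquality)
open import Relation.Binary.PropositionalEquality using (_≡_; _≢_; refl; sym; trans; cong; subst)

open Equivalence using (to; from)

module _ {A : Set} where

  lookup-injective : ∀ {xs : List A} → Unique xs → ∀ {i j} → lookup xs i ≡ lookup xs j → i ≡ j
  lookup-injective (_ ∷ _) {zero} {zero} _ = refl
  lookup-injective (x∉xs ∷ _) {zero} {suc j} eq = ⊥-elim (All.lookup x∉xs (∈-lookup j) eq)
  lookup-injective (x∉xs ∷ _) {suc i} {zero} eq = ⊥-elim (All.lookup x∉xs (∈-lookup i) (sym eq))
  lookup-injective (_ ∷ u) {suc i} {suc j} eq = cong suc (lookup-injective u eq)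

  ∈-─ : ∀ {x y : A} {ys} (x∈ys : x ∈ ys) → y ∈ ys → y ≢ x → y ∈ (ys ─ x∈ys)
  ∈-─ (here refl) (here refl) y≢x = ⊥-elim (y≢x refl)
  ∈-─ (here refl) (there y∈ys) _ = y∈ys
  ∈-─ (there _) (here refl) _ = here refl
  ∈-─ (there x∈ys) (there y∈ys) y≢x = there (∈-─ x∈ys y∈ys y≢x)

  unique⊆⇒length≤ : ∀ {xs ys : List A} → Unique xs → xs ⊆ ys → length xs ≤ length ys
  unique⊆⇒length≤ [] _ = z≤n
  unique⊆⇒length≤ {x ∷ xs} {ys} (x∉xs ∷ u) xs⊆ys = begin
      suc (length xs)          ≤⟨ s≤s (unique⊆⇒length≤ u xs⊆ys─x) ⟩
      suc (length (ys ─ x∈ys)) ≡⟨ sym (length-removeAt′ ys (Any.index x∈ys)) ⟩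
      length ys                ∎
    where
    open ≤-Reasoning
    x∈ys : x ∈ ys
    x∈ys = xs⊆ys (here refl)
    xs⊆ys─x : xs ⊆ (ys ─ x∈ys)
    xs⊆ys─x y∈xs = ∈-─ x∈ys (xs⊆ys (there y∈xs)) (λ y≡x → All.lookup x∉xs y∈xs (sym y≡x))

module _ {A : Set} (_≟_ : DecidableEquality A) where
  open import Data.List.Membership.DecPropositional _≟_ using (_∈?_)

  unique-or-shorter : (ys : List A) → Unique ys ⊎ ∃[ zs ] (length zs < length ys × ys ⊆ zs)
  unique-or-shorter [] = inj₁ []
  unique-or-shorter (y ∷ ys) with y ∈? ys
  ... | yes y∈ys = inj₂ (ys , ≤-refl , λ { (here refl) → y∈ys ; (there z∈ys) → z∈ys })
  ... | no y∉ys with unique-or-shorter ys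
  ...   | inj₁ u = inj₁ (¬Any⇒All¬ ys y∉ys ∷ u)
  ...   | inj₂ (zs , shorter , ys⊆zs) =
    inj₂ (y ∷ zs , s≤s shorter , λ { (here refl) → here refl ; (there z∈ys) → there (ys⊆zs z∈ys) })

  covering-unique : ∀ {xs ys : List A} → Unique xs → xs ⊆ ys → length ys ≤ length xs → Unique ys
  covering-unique {xs} {ys} u xs⊆ys ys≤xs with unique-or-shorter ys
  ... | inj₁ uys = uys
  ... | inj₂ (zs , zs<ys , ys⊆zs) =
    ⊥-elim (<-irrefl refl (≤-trans (s≤s (unique⊆⇒length≤ u (ys⊆zs ∘ xs⊆ys))) (≤-trans zs<ys ys≤xs)))

module _ {X : Set} where

  letters-concat : (P : Quintet X) → letters P ≡ concat (blocks P)
  letters-concat (q221 _ _ _ _ _) = refl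
  letters-concat (q32 _ _ _ _ _) = refl
  letters-concat (q5 _ _ _ _ _) = refl

  letters-length : (P : Quintet X) → length (letters P) ≡ 5
  letters-length (q221 _ _ _ _ _) = refl
  letters-length (q32 _ _ _ _ _) = refl
  letters-length (q5 _ _ _ _ _) = refl

  support⇔letters : (P : Quintet X) → ∀ z → SameBlock P z z ⇔ z ∈ letters P
  support⇔letters P z = mk⇔
    (λ s → subst (z ∈_) (sym (letters-concat P)) (Any.concat⁺ (Any.map proj₁ s)))
    (λ z∈P → Any.map (λ z∈B → z∈B , z∈B) (Any.concat⁻ (blocks P) (subst (z ∈_) (letters-concat P) z∈P)))

  ≈Q⇒letters⊆ : ∀ {P P' : Quintet X} → P ≈Q P' → letters P ⊆ letters P'
  ≈Q⇒letters⊆ {P} {P'} eq {z} = to (support⇔letters P' z) ∘ to (eq z z) ∘ from (support⇔letters P z)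

module _ {X : Set} (_≟_ : DecidableEquality X) {Q : QuintetSystem X} where

  -- Every member of a quintet system is written with five distinct letters:
  -- its letters cover those of a valid quintet, and both are five.
  ∋-valid : ∀ {P} → Q ∋ P → Valid P
  ∋-valid {P} (P' , valid' , _ , eq) =
    covering-unique _≟_ valid' (≈Q⇒letters⊆ eq) (≤-reflexive (trans (letters-length P) (sym (letters-length P'))))

  thin-unique : Thin Q → ∀ {P P'} → Q ∋ P → Q ∋ P' → On P' (letters P) → P ≈Q P'
  thin-unique thin {P@(q221 a b c d e)} h h' on' =
    Thin.unique-on thin a b c d e (∋-valid {P} h) P _ (support⇔letters P) on' h h'
  thin-unique thin {P@(q32 a b c d e)} h h' on' =
    Thin.unique-on thin a b c d e (∋-valid {P} h) P _ (support⇔letters P) on' h h'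
  thin-unique thin {P@(q5 a b c d e)} h h' on' =
    Thin.unique-on thin a b c d e (∋-valid {P} h) P _ (support⇔letters P) on' h h'

module Renaming {X : Set} {k : ℕ} (e : Fin k → X) where

  rename : Quintet (Fin k) → Quintet X
  rename (q221 a b c d f) = q221 (e a) (e b) (e c) (e d) (e f)
  rename (q32 a b c d f) = q32 (e a) (e b) (e c) (e d) (e f)
  rename (q5 a b c d f) = q5 (e a) (e b) (e c) (e d) (e f)

  letters-rename : (P : Quintet (Fin k)) → letters (rename P) ≡ map e (letters P)
  letters-rename (q221 _ _ _ _ _) = refl
  letters-rename (q32 _ _ _ _ _) = refl
  letters-rename (q5 _ _ _ _ _) = refl

  blocks-rename : (P : Quintet (Fin k)) → blocks (rename P) ≡ map (map e) (blocks P)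
  blocks-rename (q221 _ _ _ _ _) = refl
  blocks-rename (q32 _ _ _ _ _) = refl
  blocks-rename (q5 _ _ _ _ _) = refl

  sameBlock-rename : ∀ (P : Quintet (Fin k)) {u v} → SameBlock P u v → SameBlock (rename P) (e u) (e v)
  sameBlock-rename P s = subst (Any _) (sym (blocks-rename P))
    (Any.map⁺ (Any.map (λ (u∈B , v∈B) → ∈-map⁺ e u∈B , ∈-map⁺ e v∈B) s))

  common-block-preimage : ∀ {x y} (Bs : List (List (Fin k))) →
    Any (λ B → x ∈ map e B × y ∈ map e B) Bs →
    ∃[ u ] ∃[ v ] (x ≡ e u × y ≡ e v × Any (λ B → u ∈ B × v ∈ B) Bs)
  common-block-preimage (B ∷ _) (here (x∈eB , y∈eB)) with ∈-map⁻ e x∈eB | ∈-map⁻ e y∈eB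
  ... | u , u∈B , x≡eu | v , v∈B , y≡ev = u , v , x≡eu , y≡ev , here (u∈B , v∈B)
  common-block-preimage (_ ∷ Bs) (there s) with common-block-preimage Bs s
  ... | u , v , x≡eu , y≡ev , s' = u , v , x≡eu , y≡ev , there s'

  sameBlock-unrename : ∀ (P : Quintet (Fin k)) {x y} → SameBlock (rename P) x y →
    ∃[ u ] ∃[ v ] (x ≡ e u × y ≡ e v × SameBlock P u v)
  sameBlock-unrename P s = common-block-preimage (blocks P) (Any.map⁻ (subst (Any _) (blocks-rename P) s))

  rename-≈ : ∀ {P P'} → P ≈Q P' → rename P ≈Q rename P'
  rename-≈ {P} {P'} eq x y = mk⇔ (transfer P P' (λ u v → to (eq u v))) (transfer P' P (λ u v → from (eq u v)))
    where
    transfer : ∀ R R' → (∀ u v → SameBlock R u v → SameBlock R' u v) →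
      SameBlock (rename R) x y → SameBlock (rename R') x y
    transfer R R' R⊆R' s with sameBlock-unrename R s
    ... | u , v , refl , refl , s' = sameBlock-rename R' (R⊆R' u v s')

  module _ (e-injective : ∀ {u v} → e u ≡ e v → u ≡ v) where

    sameBlock-reflect : ∀ (P : Quintet (Fin k)) {u v} → SameBlock (rename P) (e u) (e v) → SameBlock P u v
    sameBlock-reflect P s with sameBlock-unrename P s
    ... | _ , _ , eu≡eu' , ev≡ev' , s' rewrite e-injective eu≡eu' | e-injective ev≡ev' = s'

    rename-reflects-≈ : ∀ {P P'} → rename P ≈Q rename P' → P ≈Q P'
    rename-reflects-≈ {P} {P'} eq u v = mk⇔
      (sameBlock-reflect P' ∘ to (eq (e u) (e v)) ∘ sameBlock-rename P)
      (sameBlock-reflect P ∘ from (eq (e u) (e v)) ∘ sameBlock-rename P')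

module _ {k : ℕ} where
  open import Data.List.Membership.DecPropositional (Fin._≟_ {k}) using (_∈?_)
  open import Data.List.Relation.Binary.Subset.DecPropositional (Fin._≟_ {k}) using (_⊆?_)

  sameBlock? : (P : Quintet (Fin k)) (u v : Fin k) → Dec (SameBlock P u v)
  sameBlock? P u v = Any.any? (λ B → (u ∈? B) ×-dec (v ∈? B)) (blocks P)

  _≈Q?_ : (P P' : Quintet (Fin k)) → Dec (P ≈Q P')
  P ≈Q? P' = map′ (λ both u v → mk⇔ (proj₁ (both u v)) (proj₂ (both u v)))
                  (λ eq u v → to (eq u v) , from (eq u v))
    (Fin.all? λ u → Fin.all? λ v →
      (sameBlock? P u v →-dec sameBlock? P' u v) ×-dec (sameBlock? P' u v →-dec sameBlock? P u v))

  Rival : Quintet (Fin k) → Quintet (Fin k) → Set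
  Rival P P' = (letters P ⊆ letters P') × (letters P' ⊆ letters P) × ¬ (P ≈Q P')

  rival? : (P P' : Quintet (Fin k)) → Dec (Rival P P')
  rival? P P' = (letters P ⊆? letters P') ×-dec (letters P' ⊆? letters P) ×-dec ¬? (P ≈Q? P')

module Template {X : Set} (_≟_ : DecidableEquality X) {Q : QuintetSystem X} (thin : Thin Q)
                (L : List X) (L-distinct : Unique L) where
  open import Data.List.Relation.Unary.Unique.DecPropositional (Fin._≟_ {length L}) using (unique?)
  open Renaming (lookup L) public

  private
    Letter = Fin (length L)

  letter : Letter → X
  letter = lookup L

  letter-injective : ∀ {u v} → letter u ≡ letter v → u ≡ v
  letter-injective = lookup-injective L-distinct

  distinct : (Ys : List Letter) {_ : True (unique? Ys)} → Distinct (map letter Ys)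
  distinct Ys {u} = Unique.map⁺ letter-injective (toWitness u)

  reorder : (P P' : Quintet Letter) {_ : True (P ≈Q? P')} → Q ∋ rename P → Q ∋ rename P'
  reorder P P' {P≈P'} (R , valid , R∈Q , R≈P) =
    R , valid , R∈Q , λ x y → ⇔.trans (R≈P x y) (rename-≈ (toWitness P≈P') x y)

  rename-⊆ : ∀ (P P' : Quintet Letter) → letters P ⊆ letters P' → letters (rename P) ⊆ letters (rename P')
  rename-⊆ P P' P⊆P' rewrite letters-rename P | letters-rename P' = Subset.map⁺ letter P⊆P'

  exclusive : (P P' : Quintet Letter) {_ : True (rival? P P')} → Q ∋ rename P → Q ∋ rename P' → ⊥
  exclusive P P' {rival} h h' with toWitness rival
  ... | P⊆P' , P'⊆P , P≉P' =
    P≉P' (rename-reflects-≈ letter-injective (thin-unique _≟_ thin h h' on'))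
    where
    on' : On (rename P') (letters (rename P))
    on' z = ⇔.trans (support⇔letters (rename P') z) (mk⇔ (rename-⊆ P' P P'⊆P) (rename-⊆ P P' P⊆P'))

  bar-exclusive : (a1 a2 b1 b2 b3 : Letter) (R : Quintet Letter)
    {_ : True (rival? (q32 a1 a2 b1 b2 b3) R)} {_ : True (rival? (q221 a1 a2 b1 b2 b3) R)}
    {_ : True (rival? (q221 a1 a2 b1 b3 b2) R)} {_ : True (rival? (q221 a1 a2 b2 b3 b1) R)} →
    Bar Q (letter a1) (letter a2) (letter b1) (letter b2) (letter b3) → Q ∋ rename R → ⊥
  bar-exclusive a1 a2 b1 b2 b3 R {r₁} {r₂} {r₃} {r₄} =
    [ exclusive (q32 a1 a2 b1 b2 b3) R {r₁}
    , [ exclusive (q221 a1 a2 b1 b2 b3) R {r₂}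
      , [ exclusive (q221 a1 a2 b1 b3 b2) R {r₃} , exclusive (q221 a1 a2 b2 b3 b1) R {r₄} ] ] ]

-- Case y = x: the first quintet (a,c|b,d,x) rivals each candidate for the
-- second one, since all of them live on {a,b,c,d,x}.
module SameSupport {X : Set} (_≟_ : DecidableEquality X) {Q : QuintetSystem X} (thin : Thin Q)
                   {a b c d x : X} (H1 : Q ∋ q32 a c b d x) where
  open Template _≟_ thin (a ∷ c ∷ b ∷ d ∷ x ∷ []) (∋-valid _≟_ {P = q32 a c b d x} H1)

  a′ c′ b′ d′ x′ : Fin 5
  a′ = # 0
  c′ = # 1
  b′ = # 2
  d′ = # 3
  x′ = # 4

  refute : (Q ∋ q32 b x a c d) ⊎ (Q ∋ q221 a b c d x) → ⊥
  refute (inj₁ H2) = exclusive (q32 a′ c′ b′ d′ x′) (q32 b′ x′ a′ c′ d′) H1 H2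
  refute (inj₂ H2) = exclusive (q32 a′ c′ b′ d′ x′) (q221 a′ b′ c′ d′ x′) H1 H2

module SixLetters {X : Set} (_≟_ : DecidableEquality X) {Q : QuintetSystem X}
                  (thin : Thin Q) (sat : Saturated Q) {a b c d x y : X}
                  (H1 : Q ∋ q32 a c b d y) (x-fresh : All (x ≢_) (a ∷ c ∷ b ∷ d ∷ y ∷ [])) where
  open Template _≟_ thin (x ∷ a ∷ c ∷ b ∷ d ∷ y ∷ []) (x-fresh ∷ ∋-valid _≟_ {P = q32 a c b d y} H1)
  open Saturated sat

  x′ a′ c′ b′ d′ y′ : Fin 6
  x′ = # 0
  a′ = # 1
  c′ = # 2
  b′ = # 3
  d′ = # 4
  y′ = # 5

  -- Saturation (ii) at (a,c|b,d,y)
  -- with x gives (a,x|b,d,y), since the alternatives (a,c|overline{b,d,x})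
  -- rival (b,x|a,c,d).  Then saturation (ii) at (b,x|a,d,c) with y gives
  -- (b,y|a,d,c), a rival of (a,c|b,d,y), or an alternative of
  -- (b,x|overline{a,d,y}), a rival of (a,x|b,d,y).
  refute-triple : Q ∋ q32 b x a c d → ⊥
  refute-triple H2 = case sat2 a c b d y x (distinct (a′ ∷ c′ ∷ b′ ∷ d′ ∷ y′ ∷ x′ ∷ [])) H1 of λ where
    (inj₂ bar) → bar-exclusive a′ c′ b′ d′ x′ (q32 b′ x′ a′ c′ d′) bar H2
    (inj₁ H3) → case sat2 b x a d c y (distinct (b′ ∷ x′ ∷ a′ ∷ d′ ∷ c′ ∷ y′ ∷ []))
                                     (reorder (q32 b′ x′ a′ c′ d′) (q32 b′ x′ a′ d′ c′) H2) of λ where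
      (inj₁ h) → exclusive (q32 b′ y′ a′ d′ c′) (q32 a′ c′ b′ d′ y′) h H1
      (inj₂ bar) → bar-exclusive b′ x′ a′ d′ y′ (q32 a′ x′ b′ d′ y′) bar H3

  -- As before (a,x|b,d,y) ∈ Q.
  -- Saturation (i) at (b,a|d,c|x) with y gives a rival of (a,c|b,d,y), a
  -- rival of (a,x|b,d,y), or (b,y|d,c|x).  In the last case saturation (ii)
  -- at (c,a|b,d,y) with x gives (c,x|b,d,y), a rival of (b,y|d,c|x), or an
  -- alternative of (c,a|overline{b,d,x}), a rival of (a,b|c,d|x).
  refute-pairs : Q ∋ q221 a b c d x → ⊥
  refute-pairs H2 = case sat2 a c b d y x (distinct (a′ ∷ c′ ∷ b′ ∷ d′ ∷ y′ ∷ x′ ∷ [])) H1 of λ where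
    (inj₂ bar) → bar-exclusive a′ c′ b′ d′ x′ (q221 a′ b′ c′ d′ x′) bar H2
    (inj₁ H3) → case sat1 b a d c x y (distinct (b′ ∷ a′ ∷ d′ ∷ c′ ∷ x′ ∷ y′ ∷ []))
                                     (reorder (q221 a′ b′ c′ d′ x′) (q221 b′ a′ d′ c′ x′) H2) of λ where
      (inj₁ h) → exclusive (q221 b′ a′ d′ c′ y′) (q32 a′ c′ b′ d′ y′) h H1
      (inj₂ (inj₂ h)) → exclusive (q221 b′ a′ d′ y′ x′) (q32 a′ x′ b′ d′ y′) h H3
      (inj₂ (inj₁ H5)) → case sat2 c a b d y x (distinct (c′ ∷ a′ ∷ b′ ∷ d′ ∷ y′ ∷ x′ ∷ []))
                                             (reorder (q32 a′ c′ b′ d′ y′) (q32 c′ a′ b′ d′ y′) H1) of λ where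
        (inj₁ h) → exclusive (q32 c′ x′ b′ d′ y′) (q221 b′ y′ d′ c′ x′) h H5
        (inj₂ bar) → bar-exclusive c′ a′ b′ d′ x′ (q221 a′ b′ c′ d′ x′) bar H2

-- When y ≠ x, the letter x is new with respect to (a,c|b,d,y): it differs
-- from a, b, c, d because the second quintet is valid.
module _ {X : Set} {a b c d x y : X} (x≢y : x ≢ y) where

  fresh-from-triple : Valid (q32 b x a c d) → All (x ≢_) (a ∷ c ∷ b ∷ d ∷ y ∷ [])
  fresh-from-triple ((b≢x ∷ _) ∷ (x≢a ∷ x≢c ∷ x≢d ∷ []) ∷ _) =
    x≢a ∷ x≢c ∷ b≢x ∘ sym ∷ x≢d ∷ x≢y ∷ []

  fresh-from-pairs : Valid (q221 a b c d x) → All (x ≢_) (a ∷ c ∷ b ∷ d ∷ y ∷ [])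
  fresh-from-pairs ((_ ∷ _ ∷ _ ∷ a≢x ∷ []) ∷ (_ ∷ _ ∷ b≢x ∷ []) ∷ (_ ∷ c≢x ∷ []) ∷ (d≢x ∷ []) ∷ _) =
    a≢x ∘ sym ∷ c≢x ∘ sym ∷ b≢x ∘ sym ∷ d≢x ∘ sym ∷ x≢y ∷ []

lemma3p4 : (n : ℕ) (Q : QuintetSystem (Fin (suc n))) →
    Thin Q → Transitive Q → Saturated Q →
    ¬ (∃[ a ] ∃[ b ] ∃[ c ] ∃[ d ] ∃[ x ] ∃[ y ]
        ((Q ∋ q32 a c b d y) × ((Q ∋ q32 b x a c d) ⊎ (Q ∋ q221 a b c d x))))
lemma3p4 n Q thin _ sat (a , b , c , d , x , y , H1 , H2) with x Fin.≟ y | H2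
... | yes refl | _ = SameSupport.refute Fin._≟_ thin H1 H2
... | no x≢y | inj₁ triple = SixLetters.refute-triple Fin._≟_ thin sat H1
  (fresh-from-triple x≢y (∋-valid Fin._≟_ {P = q32 b x a c d} triple)) triple
... | no x≢y | inj₂ pairs = SixLetters.refute-pairs Fin._≟_ thin sat H1
  (fresh-from-pairs x≢y (∋-valid Fin._≟_ {P = q221 a b c d x} pairs)) pairs
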